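{- Let $n=n_1+n_2$ and let $f(\mathbf{x},\mathbf{y})=(\phi(\mathbf{x})\cdot\mathbf{y})\oplus g(\mathbf{x})$ with $\mathbf{x}\in\mathbb{F}_2^{n_1}$, $\mathbf{y}\in\mathbb{F}_2^{n_2}$, $\phi:\mathbb{F}_2^{n_1}\to\mathbb{F}_2^{n_2}$, $g:\mathbb{F}_2^{n_1}\to\mathbb{F}_2$, satisfying: (1) $\phi(\mathbf{1}_{n_1})=\mathbf{1}_{n_2}$ and $g(\mathbf{1}_{n_1})=0$; (2) for every $1\le i\le n_1$, the Hamming weight of $\phi(\mathbf{1}_{n_1}^i)$ is odd and $g(\mathbf{1}_{n_1}^i)\equiv n_2\pmod 2$. Then $s(f)=n$.
   Context: $\mathbf{1}_m$ is the all-ones vector of length $m$ and $\mathbf{1}_{n_1}^i$ is $\mathbf{1}_{n_1}$ with its $i$-th bit flipped. The sensitivity is $s(f)=\max_{\mathbf{z}}|\{i: f(\mathbf{z})\ne f(\mathbf{z}^i)\}|$, where $\mathbf{z}^i$ is $\mathbf{z}$ with the $i$-th bit flipped. -}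

module Defs where

open import Data.Bool using (Bool; true; false; not; _xor_; _∧_; if_then_else_)
open import Data.Nat using (ℕ; zero; suc; _+_; _⊔_)
open import Data.Nat.Properties using ()
open import Data.Fin using (Fin)
open import Data.Vec using (Vec; []; _∷_; replicate; updateAt; zipWith; foldr; splitAt; _++_; count; tabulate; map; allFin)
open import Data.List using (List; []; _∷_; concatMap)
import Data.List as L
open import Data.Product using (_,_; proj₁; proj₂)
open import Relation.Nullary using (¬_)
open import Relation.Binary.PropositionalEquality using (_≡_)
open import Data.Bool.Properties using () renaming (_≟_ to _≟B_)
open import Relation.Nullary.Decidable using (¬?)

-- Vectors over F₂ are Vec Bool n (true = 1, false = 0, xor = addition).

𝟏 : (m : ℕ) → Vec Bool m
𝟏 m = replicate m true

flipAt : ∀ {n} → Fin n → Vec Bool n → Vec Bool n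
flipAt i z = updateAt z i not

dot : ∀ {n} → Vec Bool n → Vec Bool n → Bool
dot u v = foldr _ _xor_ false (zipWith _∧_ u v)

weight : ∀ {n} → Vec Bool n → ℕ
weight v = count (λ b → b ≟B true) v

parity : ℕ → Bool
parity zero = false
parity (suc k) = not (parity k)

mkF : (n₁ n₂ : ℕ) → (Vec Bool n₁ → Vec Bool n₂) → (Vec Bool n₁ → Bool)
    → Vec Bool (n₁ + n₂) → Bool
mkF n₁ n₂ φ g z with splitAt n₁ z
... | x , y , _ = dot (φ x) y xor g x

allVecs : (n : ℕ) → List (Vec Bool n)
allVecs zero = [] ∷ []
allVecs (suc n) = concatMap (λ v → (false ∷ v) ∷ (true ∷ v) ∷ []) (allVecs n)

sensAt : ∀ {n} → (Vec Bool n → Bool) → Vec Bool n → ℕ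
sensAt {n} f z = count (λ i → ¬? (f z ≟B f (flipAt i z))) (allFin n)

sensitivity : ∀ {n} → (Vec Bool n → Bool) → ℕ
sensitivity {n} f = L.foldr _⊔_ 0 (L.map (sensAt f) (allVecs n))

-- Every coordinate is sensitive at z = 1_n, where f(1_n) = 1·1 = n₂ mod 2.  Flipping a bit
-- of y changes φ(1)·y = 1·y by one and leaves g(1) = 0 alone; flipping bit i of x gives
-- |φ(1^i)| ⊕ g(1^i) = 1 ⊕ n₂.  Since s(f) ≤ n trivially, s(f) = n.
module Submission where

open import Defs
open import Data.Bool using (Bool; true; false; not; _xor_)
open import Data.Bool.Properties using (not-involutive; not-¬; xor-identityʳ; true-xor)
open import Data.Nat using (ℕ; zero; suc; _+_; _≤_; _⊔_; z≤n)
open import Data.Nat.Properties using (≤-antisym; ⊔-lub; m≤m⊔n; m≤n⇒m≤o⊔n)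
open import Data.Fin using (Fin)
import Data.Fin as Fin
open import Data.Vec using (Vec; []; _∷_; _++_; splitAt; count; allFin)
open import Data.Vec.Properties using (count≤n; ++-injective)
open import Data.List using (List; foldr)
import Data.List as List
open import Data.List.Membership.Propositional using (_∈_)
open import Data.List.Membership.Propositional.Properties using (∈-concatMap⁺)
open import Data.List.Relation.Unary.Any as Any using (here; there)
open import Data.Product using (Σ; _,_)
open import Data.Sum using (_⊎_; inj₁; inj₂)
open import Relation.Nullary using (yes; no; contradiction)
open import Relation.Unary using (Pred; Decidable)
open import Relation.Binary.PropositionalEquality
  using (_≡_; _≢_; refl; cong; cong₂; sym; trans; subst; module ≡-Reasoning)

count-universal : ∀ {a p} {A : Set a} {P : Pred A p} (P? : Decidable P) →
  (∀ x → P x) → ∀ {n} (xs : Vec A n) → count P? xs ≡ n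
count-universal P? all [] = refl
count-universal P? all (x ∷ xs) with P? x
... | yes _ = cong suc (count-universal P? all xs)
... | no ¬px = contradiction (all x) ¬px

map-⊔-lub : ∀ {a} {A : Set a} (h : A → ℕ) {m} → (∀ x → h x ≤ m) →
  (xs : List A) → foldr _⊔_ 0 (List.map h xs) ≤ m
map-⊔-lub h bound List.[]       = z≤n
map-⊔-lub h bound (x List.∷ xs) = ⊔-lub (bound x) (map-⊔-lub h bound xs)

∈⇒≤map-⊔ : ∀ {a} {A : Set a} (h : A → ℕ) {x} {xs : List A} →
  x ∈ xs → h x ≤ foldr _⊔_ 0 (List.map h xs)
∈⇒≤map-⊔ h                   (here refl) = m≤m⊔n _ _
∈⇒≤map-⊔ h {xs = y List.∷ _} (there x∈xs) = m≤n⇒m≤o⊔n (h y) (∈⇒≤map-⊔ h x∈xs)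

∈-allVecs : ∀ {n} (v : Vec Bool n) → v ∈ allVecs n
∈-allVecs []          = here refl
∈-allVecs (false ∷ v) = ∈-concatMap⁺ _ (Any.map (λ { refl → here refl }) (∈-allVecs v))
∈-allVecs (true ∷ v)  = ∈-concatMap⁺ _ (Any.map (λ { refl → there (here refl) }) (∈-allVecs v))

sensitivity≤n : ∀ {n} (f : Vec Bool n → Bool) → sensitivity f ≤ n
sensitivity≤n {n} f = map-⊔-lub (sensAt f) (λ z → count≤n _ (allFin n)) (allVecs n)

sensAt≤sensitivity : ∀ {n} (f : Vec Bool n → Bool) (z : Vec Bool n) → sensAt f z ≤ sensitivity f
sensAt≤sensitivity f z = ∈⇒≤map-⊔ (sensAt f) (∈-allVecs z)

sensitivity-full : ∀ {n} (f : Vec Bool n → Bool) (z : Vec Bool n) →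
  (∀ i → f z ≢ f (flipAt i z)) → sensitivity f ≡ n
sensitivity-full {n} f z sensitive = ≤-antisym (sensitivity≤n f)
  (subst (_≤ sensitivity f) (count-universal _ sensitive (allFin n)) (sensAt≤sensitivity f z))

mkF-++ : ∀ n₁ n₂ φ g (x : Vec Bool n₁) (y : Vec Bool n₂) →
  mkF n₁ n₂ φ g (x ++ y) ≡ dot (φ x) y xor g x
mkF-++ n₁ n₂ φ g x y with splitAt n₁ (x ++ y)
... | x′ , y′ , eq with ++-injective x x′ eq
...   | refl , refl = refl

𝟏-++ : ∀ m n → 𝟏 (m + n) ≡ 𝟏 m ++ 𝟏 n
𝟏-++ zero    n = refl
𝟏-++ (suc m) n = cong (true ∷_) (𝟏-++ m n)

flipAt-++ : ∀ {m n} (x : Vec Bool m) (y : Vec Bool n) (i : Fin (m + n)) →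
  Σ (Fin m) (λ j → flipAt i (x ++ y) ≡ flipAt j x ++ y) ⊎
  Σ (Fin n) (λ k → flipAt i (x ++ y) ≡ x ++ flipAt k y)
flipAt-++ []      y i          = inj₂ (i , refl)
flipAt-++ (b ∷ x) y Fin.zero   = inj₁ (Fin.zero , refl)
flipAt-++ (b ∷ x) y (Fin.suc i) with flipAt-++ x y i
... | inj₁ (j , eq) = inj₁ (Fin.suc j , cong (b ∷_) eq)
... | inj₂ (k , eq) = inj₂ (k , cong (b ∷_) eq)

dot-𝟏ʳ : ∀ {m} (v : Vec Bool m) → dot v (𝟏 m) ≡ parity (weight v)
dot-𝟏ʳ []          = refl
dot-𝟏ʳ (true ∷ v)  = cong not (dot-𝟏ʳ v)
dot-𝟏ʳ (false ∷ v) = dot-𝟏ʳ v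

dot-𝟏-𝟏 : ∀ m → dot (𝟏 m) (𝟏 m) ≡ parity m
dot-𝟏-𝟏 zero    = refl
dot-𝟏-𝟏 (suc m) = cong not (dot-𝟏-𝟏 m)

dot-𝟏-flipAt-𝟏 : ∀ {m} (j : Fin m) → dot (𝟏 m) (flipAt j (𝟏 m)) ≡ not (parity m)
dot-𝟏-flipAt-𝟏 {suc m} Fin.zero    = trans (dot-𝟏-𝟏 m) (sym (not-involutive (parity m)))
dot-𝟏-flipAt-𝟏 {suc m} (Fin.suc j) = cong not (dot-𝟏-flipAt-𝟏 j)

module AllOnesFullySensitive (n₁ n₂ : ℕ) (φ : Vec Bool n₁ → Vec Bool n₂) (g : Vec Bool n₁ → Bool)
         (φ𝟏 : φ (𝟏 n₁) ≡ 𝟏 n₂) (g𝟏 : g (𝟏 n₁) ≡ false)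
         (odd-φ : (i : Fin n₁) → parity (weight (φ (flipAt i (𝟏 n₁)))) ≡ true)
         (g-flip : (i : Fin n₁) → g (flipAt i (𝟏 n₁)) ≡ parity n₂)
  where

  private
    f : Vec Bool (n₁ + n₂) → Bool
    f = mkF n₁ n₂ φ g

  open ≡-Reasoning

  mkF-𝟏 : f (𝟏 (n₁ + n₂)) ≡ parity n₂
  mkF-𝟏 = begin
    f (𝟏 (n₁ + n₂))                       ≡⟨ cong f (𝟏-++ n₁ n₂) ⟩
    f (𝟏 n₁ ++ 𝟏 n₂)                      ≡⟨ mkF-++ n₁ n₂ φ g (𝟏 n₁) (𝟏 n₂) ⟩
    dot (φ (𝟏 n₁)) (𝟏 n₂) xor g (𝟏 n₁)    ≡⟨ cong₂ (λ u b → dot u (𝟏 n₂) xor b) φ𝟏 g𝟏 ⟩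
    dot (𝟏 n₂) (𝟏 n₂) xor false           ≡⟨ xor-identityʳ _ ⟩
    dot (𝟏 n₂) (𝟏 n₂)                     ≡⟨ dot-𝟏-𝟏 n₂ ⟩
    parity n₂                             ∎

  mkF-flipAt-𝟏 : ∀ i → f (flipAt i (𝟏 (n₁ + n₂))) ≡ not (parity n₂)
  mkF-flipAt-𝟏 i rewrite 𝟏-++ n₁ n₂ with flipAt-++ (𝟏 n₁) (𝟏 n₂) i
  ... | inj₁ (j , eq) = begin
    f (flipAt i (𝟏 n₁ ++ 𝟏 n₂))                    ≡⟨ cong f eq ⟩
    f (flipAt j (𝟏 n₁) ++ 𝟏 n₂)                    ≡⟨ mkF-++ n₁ n₂ φ g (flipAt j (𝟏 n₁)) (𝟏 n₂) ⟩
    dot (φ x) (𝟏 n₂) xor g x                       ≡⟨ cong₂ _xor_ (dot-𝟏ʳ (φ x)) (g-flip j) ⟩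
    parity (weight (φ x)) xor parity n₂            ≡⟨ cong (_xor parity n₂) (odd-φ j) ⟩
    true xor parity n₂                             ≡⟨ true-xor (parity n₂) ⟩
    not (parity n₂)                                ∎
    where x = flipAt j (𝟏 n₁)
  ... | inj₂ (k , eq) = begin
    f (flipAt i (𝟏 n₁ ++ 𝟏 n₂))                    ≡⟨ cong f eq ⟩
    f (𝟏 n₁ ++ flipAt k (𝟏 n₂))                    ≡⟨ mkF-++ n₁ n₂ φ g (𝟏 n₁) (flipAt k (𝟏 n₂)) ⟩
    dot (φ (𝟏 n₁)) (flipAt k (𝟏 n₂)) xor g (𝟏 n₁) ≡⟨ cong₂ (λ u b → dot u (flipAt k (𝟏 n₂)) xor b) φ𝟏 g𝟏 ⟩
    dot (𝟏 n₂) (flipAt k (𝟏 n₂)) xor false         ≡⟨ xor-identityʳ _ ⟩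
    dot (𝟏 n₂) (flipAt k (𝟏 n₂))                   ≡⟨ dot-𝟏-flipAt-𝟏 k ⟩
    not (parity n₂)                                ∎

mainTheorem11 : (n₁ n₂ : ℕ) (φ : Vec Bool n₁ → Vec Bool n₂) (g : Vec Bool n₁ → Bool)
    → φ (𝟏 n₁) ≡ 𝟏 n₂
    → g (𝟏 n₁) ≡ false
    → ((i : Fin n₁) → parity (weight (φ (flipAt i (𝟏 n₁)))) ≡ true)
    → ((i : Fin n₁) → g (flipAt i (𝟏 n₁)) ≡ parity n₂)
    → sensitivity (mkF n₁ n₂ φ g) ≡ n₁ + n₂
mainTheorem11 n₁ n₂ φ g φ𝟏 g𝟏 odd-φ g-flip =
  sensitivity-full (mkF n₁ n₂ φ g) (𝟏 (n₁ + n₂))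
    (λ i flip-invariant → not-¬ mkF-𝟏 (trans flip-invariant (mkF-flipAt-𝟏 i)))
  where open AllOnesFullySensitive n₁ n₂ φ g φ𝟏 g𝟏 odd-φ g-flip
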